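{- Let $m,n$ be positive integers and let $b_i=m(i-1)$ for $i=1,2,\ldots$. Then \[C^{(\mathbf b)}(n)=\sum_{k=1}^n\binom{n-1}{2k-1}m^k.\]
   Context: Given a sequence $\mathbf b=(b_1,b_2,\ldots)$ of nonnegative integers and positive integers $n,k$, $C^{(\mathbf b)}(n,k)=\sum b_{i_1}\cdots b_{i_k}$, the sum over all $k$-tuples of positive integers with sum $n$, and $C^{(\mathbf b)}(n)=\sum_{k=1}^nC^{(\mathbf b)}(n,k)$ (number of all compositions of $n$ where a part equal to $j$ comes in $b_j$ types). Binomial coefficients $\binom{a}{b}$ are $0$ when $a<b$. -}

module Defs where

open import Data.Nat using (ℕ; zero; suc; _+_; _*_; _∸_)

sum1to : ℕ → (ℕ → ℕ) → ℕ
sum1to zero    f = 0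
sum1to (suc n) f = sum1to n f + f (suc n)

-- C^(b)(n,k) = Σ b_{i_1} ⋯ b_{i_k} over all k-tuples (i_1,…,i_k) of positive
-- integers with i_1 + ⋯ + i_k = n.  Enumerated by the first part i_1 = j:
-- the remaining (k-1)-tuple sums to n - j.  For k = 0 the only tuple is the
-- empty one, summing to 0.  The sequence b is given as a function with b j
-- meaning b_j (b 0 is never used).
Comp : (ℕ → ℕ) → ℕ → ℕ → ℕ
Comp b zero    zero    = 1
Comp b (suc n) zero    = 0
Comp b n       (suc k) = sum1to n (λ j → b j * Comp b (n ∸ j) k)

CompTotal : (ℕ → ℕ) → ℕ → ℕ
CompTotal b n = sum1to n (λ k → Comp b n k)

-- With b_i = m(i-1), a composition of n into k+1 parts weighted by b has
--   C^(b)(n, k+1) = C(n-1, 2k+1) m^(k+1),                         (★)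
-- and summing (★) over the number of parts gives the corollary.
--
-- For one part, C^(b)(n,1) = b_n = m(n-1).
-- For k+2 parts, split off the first part j: by induction
--   C^(b)(n, k+2) = m^(k+2) Σ_{j=1}^{n} (j-1) C(n-j-1, 2k+1),
-- and the sum is the Vandermonde-type convolution
--   Σ_{j=1}^{n} (j-1) C(n-j-1, r+1) = C(n-1, r+3),
-- itself proved by induction on n from the hockey-stick identity
--   Σ_{j=1}^{n} C(n-j-1, r+1) = C(n-1, r+2).
module Submission where

open import Defs
open import Data.Nat using (ℕ; zero; suc; _+_; _*_; _∸_; _^_; NonZero; _<_; s≤s)
open import Data.Nat.Properties
  using (+-comm; +-assoc; *-comm; *-identityʳ; *-zeroʳ; *-distribˡ-+;
         +-∸-assoc; n∸n≡0; n<1+n; m<n⇒m<1+n; +-suc)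
open import Data.Nat.Combinatorics using (_C_; nC1≡n; nCk+nC[k+1]≡[n+1]C[k+1])
open import Relation.Binary.PropositionalEquality
  using (_≡_; refl; sym; cong; cong₂; module ≡-Reasoning)
open import Data.Nat.Solver using (module +-*-Solver)
open +-*-Solver using (solve; _:+_; _:*_; _:=_)

sum1to-cong : ∀ n (f g : ℕ → ℕ) → (∀ j → j < n → f (suc j) ≡ g (suc j)) →
              sum1to n f ≡ sum1to n g
sum1to-cong zero    f g f≗g = refl
sum1to-cong (suc n) f g f≗g =
  cong₂ _+_ (sum1to-cong n f g (λ j j<n → f≗g j (m<n⇒m<1+n j<n))) (f≗g n (n<1+n n))

sum1to-+ : ∀ n (f g : ℕ → ℕ) →
           sum1to n (λ j → f j + g j) ≡ sum1to n f + sum1to n g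
sum1to-+ zero    f g = refl
sum1to-+ (suc n) f g rewrite sum1to-+ n f g =
  solve 4 (λ a b c d → (a :+ b) :+ (c :+ d) := (a :+ c) :+ (b :+ d)) refl
    (sum1to n f) (sum1to n g) (f (suc n)) (g (suc n))

sum1to-*ˡ : ∀ n c (f : ℕ → ℕ) → sum1to n (λ j → c * f j) ≡ c * sum1to n f
sum1to-*ˡ zero    c f = sym (*-zeroʳ c)
sum1to-*ˡ (suc n) c f rewrite sum1to-*ˡ n c f = sym (*-distribˡ-+ c (sum1to n f) (f (suc n)))

sum1to-first : ∀ n (f : ℕ → ℕ) → sum1to (suc n) f ≡ f 1 + sum1to n (λ j → f (suc j))
sum1to-first zero    f = +-comm 0 (f 1)
sum1to-first (suc n) f rewrite sum1to-first n f = +-assoc (f 1) _ _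

sum1to-vanishing : ∀ n (f : ℕ → ℕ) → (∀ j → j < n → f (suc j) ≡ 0) → sum1to n f ≡ 0
sum1to-vanishing zero    f f≗0 = refl
sum1to-vanishing (suc n) f f≗0 =
  cong₂ _+_ (sum1to-vanishing n f (λ j j<n → f≗0 j (m<n⇒m<1+n j<n))) (f≗0 n (n<1+n n))

-- Pascal's rule in terms of n-1 instead of n; it also holds for n = 0,
-- since the right-hand index is at least 1.
pascal-pred : ∀ n r → (n ∸ 1) C suc r + (n ∸ 1) C suc (suc r) ≡ n C suc (suc r)
pascal-pred zero    r = refl
pascal-pred (suc n) r = nCk+nC[k+1]≡[n+1]C[k+1] n (suc r)

hockey-stick : ∀ r n → sum1to n (λ j → (n ∸ j ∸ 1) C suc r) ≡ (n ∸ 1) C suc (suc r)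
hockey-stick r zero    = refl
hockey-stick r (suc n) = begin
  sum1to (suc n) (λ j → (suc n ∸ j ∸ 1) C suc r)   ≡⟨ sum1to-first n _ ⟩
  (n ∸ 1) C suc r + sum1to n (λ j → (n ∸ j ∸ 1) C suc r)
                                                    ≡⟨ cong ((n ∸ 1) C suc r +_) (hockey-stick r n) ⟩
  (n ∸ 1) C suc r + (n ∸ 1) C suc (suc r)           ≡⟨ pascal-pred n r ⟩
  n C suc (suc r)                                   ∎
  where open ≡-Reasoning

-- Convolution:  Σ_{j=1}^{n} (j-1) C(n-j-1, r+1) = C(n-1, r+3).
-- Shifting j by one turns the weight j-1 into (j-1) + 1, so the step from n
-- to n+1 adds a hockey-stick sum.
convolution : ∀ r n →
  sum1to n (λ j → (j ∸ 1) * ((n ∸ j ∸ 1) C suc r)) ≡ (n ∸ 1) C suc (suc (suc r))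
convolution r zero    = refl
convolution r (suc n) = begin
  sum1to (suc n) (λ j → (j ∸ 1) * ((suc n ∸ j ∸ 1) C suc r))
    ≡⟨ sum1to-first n _ ⟩
  sum1to n (λ j → j * ((n ∸ j ∸ 1) C suc r))
    ≡⟨ sum1to-cong n _ _ (λ j _ → +-comm _ (j * _)) ⟩
  sum1to n (λ j → (j ∸ 1) * ((n ∸ j ∸ 1) C suc r) + (n ∸ j ∸ 1) C suc r)
    ≡⟨ sum1to-+ n _ _ ⟩
  sum1to n (λ j → (j ∸ 1) * ((n ∸ j ∸ 1) C suc r)) + sum1to n (λ j → (n ∸ j ∸ 1) C suc r)
    ≡⟨ cong₂ _+_ (convolution r n) (hockey-stick r n) ⟩
  (n ∸ 1) C suc (suc (suc r)) + (n ∸ 1) C suc (suc r)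
    ≡⟨ +-comm ((n ∸ 1) C suc (suc (suc r))) _ ⟩
  (n ∸ 1) C suc (suc r) + (n ∸ 1) C suc (suc (suc r))
    ≡⟨ pascal-pred n (suc r) ⟩
  n C suc (suc (suc r)) ∎
  where open ≡-Reasoning

comp-single-part : ∀ b n → Comp b (suc n) 1 ≡ b (suc n)
comp-single-part b n = begin
  sum1to n f + b (suc n) * Comp b (n ∸ n) 0
    ≡⟨ cong₂ _+_ (sum1to-vanishing n f f≗0) (cong (λ e → b (suc n) * Comp b e 0) (n∸n≡0 n)) ⟩
  b (suc n) * 1
    ≡⟨ *-identityʳ (b (suc n)) ⟩
  b (suc n) ∎
  where
  open ≡-Reasoning
  f : ℕ → ℕ
  f j = b j * Comp b (suc n ∸ j) 0
  -- a first part j ≤ n leaves a positive remainder, which has no composition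
  -- into zero parts
  f≗0 : ∀ j → j < n → f (suc j) ≡ 0
  f≗0 j (s≤s j<n) rewrite +-∸-assoc 1 j<n = *-zeroʳ (b (suc j))

2*suc : ∀ k → 2 * suc k ≡ suc (suc (2 * k))
2*suc k = cong suc (+-suc k (1 * k))

linear-weights : ℕ → ℕ → ℕ
linear-weights m i = m * (i ∸ 1)

comp-formula : ∀ m k n →
  Comp (linear-weights m) n (suc k) ≡ ((n ∸ 1) C suc (2 * k)) * m ^ suc k
comp-formula m zero    zero    = refl
comp-formula m zero    (suc n) = begin
  Comp b (suc n) 1   ≡⟨ comp-single-part b n ⟩
  m * n              ≡⟨ *-comm m n ⟩
  n * m              ≡⟨ cong₂ _*_ (sym (nC1≡n n)) (sym (*-identityʳ m)) ⟩
  (n C 1) * (m * 1)  ∎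
  where
  open ≡-Reasoning
  b : ℕ → ℕ
  b = linear-weights m
comp-formula m (suc k) zero    = refl
comp-formula m (suc k) n@(suc _) = begin
  sum1to n (λ j → b j * Comp b (n ∸ j) (suc k))
    ≡⟨ sum1to-cong n _ _ (λ j _ → cong (b (suc j) *_) (comp-formula m k (n ∸ suc j))) ⟩
  sum1to n (λ j → b j * (((n ∸ j ∸ 1) C suc (2 * k)) * m ^ suc k))
    ≡⟨ sum1to-cong n _ _ (λ j _ → regroup j ((n ∸ suc j ∸ 1) C suc (2 * k))) ⟩
  sum1to n (λ j → m ^ suc (suc k) * ((j ∸ 1) * ((n ∸ j ∸ 1) C suc (2 * k))))
    ≡⟨ sum1to-*ˡ n (m ^ suc (suc k)) _ ⟩
  m ^ suc (suc k) * sum1to n (λ j → (j ∸ 1) * ((n ∸ j ∸ 1) C suc (2 * k)))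
    ≡⟨ cong (m ^ suc (suc k) *_) (convolution (2 * k) n) ⟩
  m ^ suc (suc k) * ((n ∸ 1) C suc (suc (suc (2 * k))))
    ≡⟨ *-comm (m ^ suc (suc k)) _ ⟩
  ((n ∸ 1) C suc (suc (suc (2 * k)))) * m ^ suc (suc k)
    ≡⟨ cong (λ e → ((n ∸ 1) C suc e) * m ^ suc (suc k)) (sym (2*suc k)) ⟩
  ((n ∸ 1) C suc (2 * suc k)) * m ^ suc (suc k) ∎
  where
  open ≡-Reasoning
  b : ℕ → ℕ
  b = linear-weights m
  regroup : ∀ a c → m * a * (c * m ^ suc k) ≡ m ^ suc (suc k) * (a * c)
  regroup a c = solve 4 (λ m a c p → m :* a :* (c :* p) := m :* p :* (a :* c))
                  refl m a c (m ^ suc k)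

corollary3 : (m n : ℕ) → .{{_ : NonZero m}} → .{{_ : NonZero n}} →
    CompTotal (λ i → m * (i ∸ 1)) n
      ≡ sum1to n (λ k → ((n ∸ 1) C (2 * k ∸ 1)) * m ^ k)
corollary3 m n = sum1to-cong n _ _ λ k _ → begin
  Comp (linear-weights m) n (suc k)         ≡⟨ comp-formula m k n ⟩
  ((n ∸ 1) C suc (2 * k)) * m ^ suc k       ≡⟨ cong (λ e → ((n ∸ 1) C (e ∸ 1)) * m ^ suc k) (sym (2*suc k)) ⟩
  ((n ∸ 1) C (2 * suc k ∸ 1)) * m ^ suc k   ∎
  where open ≡-Reasoning
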